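{- For every nonnegative integer $j$, $$\liminf_{k\to\infty}\frac{\Gamma_j(k)}{k}=\frac{3}{2}.$$
   Context: The Thue–Morse word $\mathbf{t}=\mathbf{t}_1\mathbf{t}_2\mathbf{t}_3\cdots=0110100110010110\cdots$ is the infinite binary word whose $i$-th letter $\mathbf{t}_i$ ($i\ge 1$) is the parity of the number of 1's in the binary expansion of $i-1$. A $k$-anti-power is a word $w^{(1)}\cdots w^{(k)}$ with $w^{(1)},\dots,w^{(k)}$ pairwise distinct words of the same length. For $j\ge0$, the $j$-fix of $\mathbf{t}$ of length $N$ is $\mathbf{t}_{j+1}\cdots\mathbf{t}_{j+N}$. $\mathcal{F}_j(k)$ is the set of odd positive integers $m$ such that the $j$-fix of $\mathbf{t}$ of length $km$ is a $k$-anti-power, and $\Gamma_j(k)=\sup\big((2\mathbb{Z}^+-1)\setminus\mathcal{F}_j(k)\big)$; for all sufficiently large $k$ this is a well-defined odd positive integer. -}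

module Defs where

open import Data.Nat using (ℕ; zero; suc; _+_; _*_; _<_; _≤_)
open import Data.Nat.DivMod using (_/_; _%_)
open import Data.Bool using (Bool; true; false; _xor_)
open import Data.List using (List; map; upTo)
open import Data.Product using (_×_)
open import Relation.Binary.PropositionalEquality using (_≡_)
open import Relation.Nullary using (¬_)

-- parity of the number of 1's in the binary expansion of n, computed with
-- fuel f (f ≥ number of binary digits of n suffices; we use f = n)
parityAux : ℕ → ℕ → Bool
parityAux zero    n = false
parityAux (suc f) n = isOne (n % 2) xor parityAux f (n / 2)
  where
  isOne : ℕ → Bool
  isOne 1 = true
  isOne _ = false

-- 0-indexed Thue–Morse word: tm n = t_{n+1} = parity of popcount(n)
tm : ℕ → Bool
tm n = parityAux n n

-- the i-th block (0-indexed) of length m of the j-fix, i.e.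
-- t_{j+i m+1} ... t_{j+i m+m}
block : ℕ → ℕ → ℕ → List Bool
block j m i = map (λ r → tm (j + i * m + r)) (upTo m)

IsAntiPowerFix : ℕ → ℕ → ℕ → Set
IsAntiPowerFix j k m =
  ∀ i i' → i < k → i' < k → block j m i ≡ block j m i' → i ≡ i'

Odd : ℕ → Set
Odd m = m % 2 ≡ 1

InF : ℕ → ℕ → ℕ → Set
InF j k m = Odd m × IsAntiPowerFix j k m

IsGamma : ℕ → ℕ → ℕ → Set
IsGamma j k g = Odd g × ¬ InF j k g × (∀ m → Odd m → g < m → InF j k m)

module Submission where

-- The whole argument rests on two arithmetic rules for t = tm: the
-- concatenation rule tm (2ⁿx + y) = tm x xor tm y (y < 2ⁿ) and the mirror
-- rule tm x xor tm (2ⁿ - 1 - x) = parity n.  From them we derive: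
--  * distance-bound: factors at distance 2ᵛ·(odd) agree on at most 3·2ᵛ
--    letters, giving an anti-power criterion for odd block lengths m.  Hence
--    Γ_j(k) exists (all odd m ≥ 3k succeed, m = 1 fails) and Γ_j(2ⁿ⁺¹) ≤ 3·2ⁿ,
--    which yields liminf ≤ 3/2 along powers of two.
--  * explicit repeated blocks at distance e = 2ⁿ: scaled-agree lifts a short
--    agreement of t to one of length ≈ C·2ⁿ.  Far repeats (m ≈ 3e, one family
--    per residue of e mod 6) and near repeats (m ≈ 2e) give, for every k in
--    (e, 2e], an odd m ≤ Γ_j(k) with 3k ≤ 2m + O(j); so liminf ≥ 3/2.
-- Sections: Thue–Morse arithmetic; factor agreement and distance-bound;
-- blocks and the anti-power criterion; existence and upper bound of Γ;
-- repeated blocks; lower witnesses; the theorem.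

open import Defs
open import Data.Bool using (Bool; true; false; _xor_; not)
open import Data.Bool.Properties
  using (not-¬; ¬-not; not-involutive; not-injective; not-distribˡ-xor; not-distribʳ-xor; xor-identityʳ)
  renaming (_≟_ to _≟ᵇ_)
open import Data.Empty using (⊥; ⊥-elim)
open import Data.List using (applyUpTo; _∷_; [])
open import Data.List.Properties using (∷-injective; map-upTo; ≡-dec)
open import Data.Nat using (ℕ; zero; suc; _+_; _*_; _∸_; _^_; _<_; _≤_; z≤n; s≤s; NonZero)
open import Data.Nat.DivMod
open import Data.Nat.Induction using (<-rec)
open import Data.Nat.Properties
open import Data.Nat.Tactic.RingSolver using (solve-∀)
open import Data.Product using (Σ; _×_; _,_; proj₁; proj₂)
open import Data.Sum using (_⊎_; inj₁; inj₂)
open import Function using (_∘_)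
open import Relation.Binary using (tri<; tri≈; tri>)
open import Relation.Binary.PropositionalEquality
open import Relation.Nullary using (¬_; Dec; yes; no)
open import Relation.Nullary.Decidable using (map′; _×-dec_; _→-dec_)

evenOrOdd : ∀ n → Σ ℕ (λ h → (n ≡ 2 * h) ⊎ (n ≡ 1 + 2 * h))
evenOrOdd zero = 0 , inj₁ refl
evenOrOdd (suc n) with evenOrOdd n
... | h , inj₁ n≡2h = h , inj₂ (cong suc n≡2h)
... | h , inj₂ n≡1+2h = suc h , inj₁ (trans (cong suc n≡1+2h) (shift h))
  where
  shift : ∀ h → suc (1 + 2 * h) ≡ 2 * suc h
  shift = solve-∀

2*n%2≡0 : ∀ n → (2 * n) % 2 ≡ 0
2*n%2≡0 n = trans (cong (_% 2) (*-comm 2 n)) (m*n%n≡0 n 2)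

2*n/2≡n : ∀ n → (2 * n) / 2 ≡ n
2*n/2≡n n = trans (cong (_/ 2) (*-comm 2 n)) (m*n/n≡m n 2)

1+2*n%2≡1 : ∀ n → (1 + 2 * n) % 2 ≡ 1
1+2*n%2≡1 n = trans (cong (λ x → (1 + x) % 2) (*-comm 2 n)) ([m+kn]%n≡m%n 1 n 2)

1+2*n/2≡n : ∀ n → (1 + 2 * n) / 2 ≡ n
1+2*n/2≡n n = trans (cong (λ x → (1 + x) / 2) (*-comm 2 n))
  (trans (+-distrib-/ 1 (n * 2) (subst (λ x → 1 + x < 2) (sym (m*n%n≡0 n 2)) (s≤s (s≤s z≤n))))
         (m*n/n≡m n 2))

≤-by-excess : ∀ {a b c} → a + b ≡ c → a ≤ c
≤-by-excess {a} {b} eq = subst (a ≤_) eq (m≤m+n a b)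

odd≢even : ∀ h k → 1 + 2 * h ≢ 2 * k
odd≢even h k eq with trans (sym (1+2*n%2≡1 h)) (trans (cong (_% 2) eq) (2*n%2≡0 k))
... | ()

private
  parityAux-0 : ∀ f → parityAux f 0 ≡ false
  parityAux-0 zero = refl
  parityAux-0 (suc f) = parityAux-0 f

  half≤ : ∀ n f → n ≤ suc f → n / 2 ≤ f
  half≤ zero f _ = z≤n
  half≤ (suc n) f le = ≤-pred (≤-trans (m/n<m (suc n) 2 (s≤s (s≤s z≤n))) le)

  parityAux-fuel : ∀ f g n → n ≤ f → n ≤ g → parityAux f n ≡ parityAux g n
  parityAux-fuel zero zero n _ _ = refl
  parityAux-fuel zero (suc g) zero _ _ = sym (parityAux-0 (suc g))
  parityAux-fuel (suc f) zero zero _ _ = parityAux-0 (suc f)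
  parityAux-fuel (suc f) (suc g) n n≤f n≤g
    with n % 2 | parityAux-fuel f g (n / 2) (half≤ n f n≤f) (half≤ n g n≤g)
  ... | zero | ih = ih
  ... | suc zero | ih = cong not ih
  ... | suc (suc _) | ih = ih

tm-even : ∀ n → tm (2 * n) ≡ tm n
tm-even zero = refl
tm-even (suc n) rewrite 2*n%2≡0 (suc n) | 2*n/2≡n (suc n) =
  parityAux-fuel (n + suc (n + 0)) (suc n) (suc n)
    (≤-trans (s≤s (m≤m+n n 0)) (m≤n+m (suc (n + 0)) n)) ≤-refl

tm-odd : ∀ n → tm (1 + 2 * n) ≡ not (tm n)
tm-odd n rewrite 1+2*n%2≡1 n | 1+2*n/2≡n n = cong not (parityAux-fuel (2 * n) n n (m≤n*m n 2) ≤-refl)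

-- Concatenation rule: the binary digits of 2ⁿx + y (y < 2ⁿ) are those of x
-- followed by those of y, so the parities of their digit sums add.
tm-concat : ∀ n x y → y < 2 ^ n → tm (2 ^ n * x + y) ≡ tm x xor tm y
tm-concat zero x zero _ = trans (cong tm (x+0≡x x)) (sym (xor-identityʳ (tm x)))
  where
  x+0≡x : ∀ x → 1 * x + 0 ≡ x
  x+0≡x = solve-∀
tm-concat zero x (suc y) (s≤s ())
tm-concat (suc n) x y y<2^n+1 with evenOrOdd y
... | h , inj₁ refl = begin
    tm (2 * 2 ^ n * x + 2 * h)  ≡⟨ cong tm (factor (2 ^ n) x h) ⟩
    tm (2 * (2 ^ n * x + h))    ≡⟨ tm-even (2 ^ n * x + h) ⟩
    tm (2 ^ n * x + h)          ≡⟨ tm-concat n x h (*-cancelˡ-< 2 h (2 ^ n) y<2^n+1) ⟩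
    tm x xor tm h               ≡⟨ cong (tm x xor_) (sym (tm-even h)) ⟩
    tm x xor tm (2 * h)         ∎
  where
  open ≡-Reasoning
  factor : ∀ p x h → 2 * p * x + 2 * h ≡ 2 * (p * x + h)
  factor = solve-∀
... | h , inj₂ refl = begin
    tm (2 * 2 ^ n * x + (1 + 2 * h))  ≡⟨ cong tm (factor (2 ^ n) x h) ⟩
    tm (1 + 2 * (2 ^ n * x + h))      ≡⟨ tm-odd (2 ^ n * x + h) ⟩
    not (tm (2 ^ n * x + h))          ≡⟨ cong not (tm-concat n x h h<2^n) ⟩
    not (tm x xor tm h)               ≡⟨ not-distribʳ-xor (tm x) (tm h) ⟩
    tm x xor not (tm h)               ≡⟨ cong (tm x xor_) (sym (tm-odd h)) ⟩
    tm x xor tm (1 + 2 * h)           ∎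
  where
  open ≡-Reasoning
  factor : ∀ p x h → 2 * p * x + (1 + 2 * h) ≡ 1 + 2 * (p * x + h)
  factor = solve-∀
  h<2^n : h < 2 ^ n
  h<2^n = *-cancelˡ-< 2 h (2 ^ n) (≤-trans (n≤1+n _) y<2^n+1)

-- parity n = (n is odd), the value of tm (2ⁿ - 1).
parity : ℕ → Bool
parity zero = false
parity (suc n) = not (parity n)

-- Mirror rule: x and 2ⁿ - 1 - x have complementary binary digits among the
-- last n, so tm x xor tm (2ⁿ - 1 - x) is the parity of n.
tm-mirror : ∀ n x z → x + z + 1 ≡ 2 ^ n → tm x xor tm z ≡ parity n
tm-mirror zero x z eq with m+n≡0⇒m≡0 x x+z≡0 | m+n≡0⇒n≡0 x x+z≡0
  where
  x+z≡0 : x + z ≡ 0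
  x+z≡0 = suc-injective (trans (sym (+-comm (x + z) 1)) eq)
... | refl | refl = refl
tm-mirror (suc n) x z eq with evenOrOdd x | evenOrOdd z
... | a , inj₁ refl | c , inj₁ refl =
  ⊥-elim (odd≢even (a + c) (2 ^ n) (trans (sym (sum a c)) eq))
  where
  sum : ∀ a c → 2 * a + 2 * c + 1 ≡ 1 + 2 * (a + c)
  sum = solve-∀
... | a , inj₁ refl | c , inj₂ refl = begin
    tm (2 * a) xor tm (1 + 2 * c)  ≡⟨ cong₂ _xor_ (tm-even a) (tm-odd c) ⟩
    tm a xor not (tm c)            ≡⟨ sym (not-distribʳ-xor (tm a) (tm c)) ⟩
    not (tm a xor tm c)            ≡⟨ cong not (tm-mirror n a c (*-cancelˡ-≡ _ _ 2 (trans (sym (sum a c)) eq))) ⟩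
    not (parity n)                 ∎
  where
  open ≡-Reasoning
  sum : ∀ a c → 2 * a + (1 + 2 * c) + 1 ≡ 2 * (a + c + 1)
  sum = solve-∀
... | a , inj₂ refl | c , inj₁ refl = begin
    tm (1 + 2 * a) xor tm (2 * c)  ≡⟨ cong₂ _xor_ (tm-odd a) (tm-even c) ⟩
    not (tm a) xor tm c            ≡⟨ sym (not-distribˡ-xor (tm a) (tm c)) ⟩
    not (tm a xor tm c)            ≡⟨ cong not (tm-mirror n a c (*-cancelˡ-≡ _ _ 2 (trans (sym (sum a c)) eq))) ⟩
    not (parity n)                 ∎
  where
  open ≡-Reasoning
  sum : ∀ a c → 1 + 2 * a + 2 * c + 1 ≡ 2 * (a + c + 1)
  sum = solve-∀
... | a , inj₂ refl | c , inj₂ refl =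
  ⊥-elim (odd≢even (a + c + 1) (2 ^ n) (trans (sym (sum a c)) eq))
  where
  sum : ∀ a c → 1 + 2 * a + (1 + 2 * c) + 1 ≡ 1 + 2 * (a + c + 1)
  sum = solve-∀

xor-cancelʳ : ∀ a b c → a xor c ≡ b xor c → a ≡ b
xor-cancelʳ false false _ _ = refl
xor-cancelʳ true true _ _ = refl
xor-cancelʳ false true false ()
xor-cancelʳ false true true ()
xor-cancelʳ true false false ()
xor-cancelʳ true false true ()

tm-digit : ∀ e n → e < 2 → tm (e + 2 * n) ≡ tm n xor tm e
tm-digit e n e<2 = trans (cong tm (swap e n)) (tm-concat 1 n e e<2)
  where
  swap : ∀ e n → e + 2 * n ≡ 2 ^ 1 * n + e
  swap = solve-∀

record Agree (a b L : ℕ) : Set where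
  constructor agree
  field letter : ∀ r → r < L → tm (a + r) ≡ tm (b + r)
open Agree public

agree-cast : ∀ {a a' b b' L} → a ≡ a' → b ≡ b' → Agree a b L → Agree a' b' L
agree-cast refl refl agr = agr

agree-sym : ∀ {a b L} → Agree a b L → Agree b a L
agree-sym agr = agree λ r r<L → sym (letter agr r r<L)

agree-shorten : ∀ {a b L L'} → L' ≤ L → Agree a b L → Agree a b L'
agree-shorten L'≤L agr = agree λ r r<L' → letter agr r (<-≤-trans r<L' L'≤L)

agree-at : ∀ {a b L} r {a' b'} → Agree a b L → r < L → a + r ≡ a' → b + r ≡ b' → tm a' ≡ tm b'
agree-at r agr r<L refl refl = letter agr r r<L

-- Agreement descends to halves: positions e + 2x + 2r of t are governed by
-- positions x + r, so agreeing at even offsets below L gives agreement at x, y.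
agree-halve : ∀ e x y L L' → e < 2 → (∀ r → r < L' → 2 * r < L) →
              Agree (e + 2 * x) (e + 2 * y) L → Agree x y L'
agree-halve e x y L L' e<2 double agr = agree λ r r<L' → xor-cancelʳ _ _ (tm e) (begin
    tm (x + r) xor tm e      ≡⟨ sym (tm-digit e (x + r) e<2) ⟩
    tm (e + 2 * (x + r))     ≡⟨ agree-at (2 * r) agr (double r r<L') (spread e x r) (spread e y r) ⟩
    tm (e + 2 * (y + r))     ≡⟨ tm-digit e (y + r) e<2 ⟩
    tm (y + r) xor tm e      ∎)
  where
  open ≡-Reasoning
  spread : ∀ e x r → e + 2 * x + 2 * r ≡ e + 2 * (x + r)
  spread = solve-∀

-- Within each aligned pair (2y, 2y+1) the letters of t differ; hence t has
-- no three equal consecutive letters.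
no-triple : ∀ y → tm y ≡ tm (1 + y) → tm (1 + y) ≡ tm (2 + y) → ⊥
no-triple y e₁ e₂ with evenOrOdd y
... | h , inj₁ refl = not-¬ refl (trans (sym (tm-even h)) (trans e₁ (tm-odd h)))
... | h , inj₂ refl = not-¬ refl (begin
    tm (suc h)                ≡⟨ sym (tm-even (suc h)) ⟩
    tm (2 * suc h)            ≡⟨ cong tm (sym (pair₁ h)) ⟩
    tm (1 + (1 + 2 * h))      ≡⟨ e₂ ⟩
    tm (2 + (1 + 2 * h))      ≡⟨ cong tm (pair₂ h) ⟩
    tm (1 + 2 * suc h)        ≡⟨ tm-odd (suc h) ⟩
    not (tm (suc h))          ∎)
  where
  open ≡-Reasoning
  pair₁ : ∀ h → 1 + (1 + 2 * h) ≡ 2 * suc h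
  pair₁ = solve-∀
  pair₂ : ∀ h → 2 + (1 + 2 * h) ≡ 1 + 2 * suc h
  pair₂ = solve-∀

-- Reading an even position of t against an odd one: the aligned pair
-- (2x, 2x+1) is (c, ¬c), so the letters y, y+1 read against it coincide.
shifted-pair : ∀ x y → tm (2 * x) ≡ tm (1 + 2 * y) → tm (1 + 2 * x) ≡ tm (2 * suc y) →
               tm y ≡ tm (suc y)
shifted-pair x y e₀ e₁ = begin
    tm y                  ≡⟨ sym (not-involutive (tm y)) ⟩
    not (not (tm y))      ≡⟨ cong not (sym (tm-odd y)) ⟩
    not (tm (1 + 2 * y))  ≡⟨ cong not (sym e₀) ⟩
    not (tm (2 * x))      ≡⟨ cong not (tm-even x) ⟩
    not (tm x)            ≡⟨ sym (tm-odd x) ⟩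
    tm (1 + 2 * x)        ≡⟨ e₁ ⟩
    tm (2 * suc y)        ≡⟨ tm-even (suc y) ⟩
    tm (suc y)            ∎
  where open ≡-Reasoning

-- A factor of length 4 at an even position never equals one at an odd
-- position: two shifted pairs would produce three equal consecutive letters.
even-odd-disagree : ∀ x y → ¬ Agree (2 * x) (1 + 2 * y) 4
even-odd-disagree x y agr =
  no-triple y (shifted-pair x y l₀ l₁) (shifted-pair (suc x) (suc y) l₂ l₃)
  where
  l₀ : tm (2 * x) ≡ tm (1 + 2 * y)
  l₀ = agree-at 0 agr (s≤s z≤n) (+-identityʳ _) (+-identityʳ _)
  l₁ : tm (1 + 2 * x) ≡ tm (2 * suc y)
  l₁ = agree-at 1 agr (s≤s (s≤s z≤n)) (+-comm (2 * x) 1) (pos₁ y)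
    where
    pos₁ : ∀ y → 1 + 2 * y + 1 ≡ 2 * suc y
    pos₁ = solve-∀
  l₂ : tm (2 * suc x) ≡ tm (1 + 2 * suc y)
  l₂ = agree-at 2 agr (s≤s (s≤s (s≤s z≤n))) (pos₂ x) (pos₂′ y)
    where
    pos₂ : ∀ x → 2 * x + 2 ≡ 2 * suc x
    pos₂ = solve-∀
    pos₂′ : ∀ y → 1 + 2 * y + 2 ≡ 1 + 2 * suc y
    pos₂′ = solve-∀
  l₃ : tm (1 + 2 * suc x) ≡ tm (2 * suc (suc y))
  l₃ = agree-at 3 agr ≤-refl (pos₃ x) (pos₃′ y)
    where
    pos₃ : ∀ x → 2 * x + 3 ≡ 1 + 2 * suc x
    pos₃ = solve-∀
    pos₃′ : ∀ y → 1 + 2 * y + 3 ≡ 2 * suc (suc y)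
    pos₃′ = solve-∀

lastDigit : ∀ a → Σ ℕ (λ e → Σ ℕ (λ x → e < 2 × a ≡ e + 2 * x))
lastDigit a with evenOrOdd a
... | x , inj₁ a≡2x = 0 , x , s≤s z≤n , a≡2x
... | x , inj₂ a≡1+2x = 1 , x , s≤s (s≤s z≤n) , a≡1+2x

-- Factors of t at distance 2ᵛ·u with u odd agree on at most 3·2ᵛ letters.
-- Halving both positions reduces v to 0, where an even position faces an
-- odd one and even-odd-disagree applies.
distance-bound : ∀ v a h L → 3 * 2 ^ v < L → ¬ Agree a (a + 2 ^ v * (1 + 2 * h)) L
distance-bound zero a h L 4≤L agr with evenOrOdd a
... | x , inj₁ refl =
  even-odd-disagree x (x + h) (agree-shorten 4≤L (agree-cast refl (distance x h) agr))
  where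
  distance : ∀ x h → 2 * x + 2 ^ 0 * (1 + 2 * h) ≡ 1 + 2 * (x + h)
  distance = solve-∀
... | x , inj₂ refl =
  even-odd-disagree (suc (x + h)) x (agree-sym (agree-shorten 4≤L (agree-cast refl (distance x h) agr)))
  where
  distance : ∀ x h → 1 + 2 * x + 2 ^ 0 * (1 + 2 * h) ≡ 2 * suc (x + h)
  distance = solve-∀
distance-bound (suc v) a h L bound agr with lastDigit a
... | e , x , e<2 , refl =
  distance-bound v x h (suc (3 * 2 ^ v)) ≤-refl
    (agree-halve e x (x + 2 ^ v * (1 + 2 * h)) L (suc (3 * 2 ^ v)) e<2 double
      (agree-cast refl (distance e x (2 ^ v) h) agr))
  where
  distance : ∀ e x p h → e + 2 * x + 2 * p * (1 + 2 * h) ≡ e + 2 * (x + p * (1 + 2 * h))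
  distance = solve-∀
  double : ∀ r → r < suc (3 * 2 ^ v) → 2 * r < L
  double r r<L' = ≤-<-trans (subst (2 * r ≤_) (twice-triple (2 ^ v)) (*-monoʳ-≤ 2 (≤-pred r<L'))) bound
    where
    twice-triple : ∀ p → 2 * (3 * p) ≡ 3 * (2 * p)
    twice-triple = solve-∀

applyUpTo-pointwise : ∀ {A : Set} n (f g : ℕ → A) →
                      applyUpTo f n ≡ applyUpTo g n → ∀ r → r < n → f r ≡ g r
applyUpTo-pointwise (suc n) f g eq zero _ = proj₁ (∷-injective eq)
applyUpTo-pointwise (suc n) f g eq (suc r) (s≤s r<n) =
  applyUpTo-pointwise n (f ∘ suc) (g ∘ suc) (proj₂ (∷-injective eq)) r r<n

applyUpTo-cong : ∀ {A : Set} n (f g : ℕ → A) →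
                 (∀ r → r < n → f r ≡ g r) → applyUpTo f n ≡ applyUpTo g n
applyUpTo-cong zero f g _ = refl
applyUpTo-cong (suc n) f g f≗g =
  cong₂ _∷_ (f≗g 0 (s≤s z≤n)) (applyUpTo-cong n (f ∘ suc) (g ∘ suc) (λ r r<n → f≗g (suc r) (s≤s r<n)))

blocks-agree : ∀ j m i i' → block j m i ≡ block j m i' → Agree (j + i * m) (j + i' * m) m
blocks-agree j m i i' eq =
  agree (applyUpTo-pointwise m _ _ (trans (sym (map-upTo _ m)) (trans eq (map-upTo _ m))))

agree-blocks : ∀ j m i i' → Agree (j + i * m) (j + i' * m) m → block j m i ≡ block j m i'
agree-blocks j m i i' agr =
  trans (map-upTo _ m) (trans (applyUpTo-cong m _ _ (letter agr)) (sym (map-upTo _ m)))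

twoAdic : ∀ d → 0 < d → Σ ℕ (λ v → Σ ℕ (λ h → d ≡ 2 ^ v * (1 + 2 * h)))
twoAdic = <-rec _ split
  where
  split : ∀ d → (∀ {d'} → d' < d → 0 < d' → Σ ℕ (λ v → Σ ℕ (λ h → d' ≡ 2 ^ v * (1 + 2 * h)))) →
          0 < d → Σ ℕ (λ v → Σ ℕ (λ h → d ≡ 2 ^ v * (1 + 2 * h)))
  split d rec d>0 with evenOrOdd d
  ... | h , inj₂ d≡odd = 0 , h , trans d≡odd (sym (*-identityˡ _))
  ... | zero , inj₁ refl = ⊥-elim (<-irrefl refl d>0)
  ... | suc c , inj₁ refl with rec {suc c} (m<m+n (suc c) (s≤s z≤n)) (s≤s z≤n)
  ...   | v , h , eq = suc v , h , trans (cong (2 *_) eq) (sym (*-assoc 2 (2 ^ v) _))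

oddHalf : ∀ m → Odd m → m ≡ 1 + 2 * (m / 2)
oddHalf m odd = trans (m≡m%n+[m/n]*n m 2) (trans (cong (_+ (m / 2) * 2) odd) (cong (1 +_) (*-comm (m / 2) 2)))

-- BlocksBeyond k m: for every distance d < k, written 2ᵛ·(odd), the block
-- length m exceeds 3·2ᵛ — the agreement bound of distance-bound.
BlocksBeyond : ℕ → ℕ → Set
BlocksBeyond k m = ∀ v h → 2 ^ v * (1 + 2 * h) < k → 3 * 2 ^ v < m

-- Blocks i and i + d of odd length m start at distance 2ᵛ·(odd·m), an odd
-- multiple of 2ᵛ, so by distance-bound they differ once 3·2ᵛ < m.
blocks-differ : ∀ j k m i d → Odd m → BlocksBeyond k m → 0 < d → i + d < k →
                block j m i ≢ block j m (i + d)
blocks-differ j k m i d odd beyond d>0 i+d<k eq with twoAdic d d>0 | oddHalf m odd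
... | v , h , refl | m≡odd =
  distance-bound v (j + i * m) (h + m / 2 + 2 * h * (m / 2)) m
    (beyond v h (≤-<-trans (m≤n+m _ i) i+d<k))
    (agree-cast refl (trans (shift j i (2 ^ v) h m) (cong (λ x → j + i * m + 2 ^ v * x) (oddProduct h (m / 2) m m≡odd)))
      (blocks-agree j m i (i + 2 ^ v * (1 + 2 * h)) eq))
  where
  shift : ∀ j i p h m → j + (i + p * (1 + 2 * h)) * m ≡ j + i * m + p * ((1 + 2 * h) * m)
  shift = solve-∀
  oddProduct : ∀ h c m → m ≡ 1 + 2 * c → (1 + 2 * h) * m ≡ 1 + 2 * (h + c + 2 * h * c)
  oddProduct h c m refl = expand h c
    where
    expand : ∀ h c → (1 + 2 * h) * (1 + 2 * c) ≡ 1 + 2 * (h + c + 2 * h * c)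
    expand = solve-∀

antiPower-criterion : ∀ j k m → Odd m → BlocksBeyond k m → InF j k m
antiPower-criterion j k m odd beyond = odd , distinct
  where
  ordered : ∀ {i i'} → i < i' → i' < k → block j m i ≢ block j m i'
  ordered {i} {i'} i<i' i'<k eq =
    blocks-differ j k m i (i' ∸ i) odd beyond (m<n⇒0<n∸m i<i')
      (subst (_< k) (sym i+d≡i') i'<k) (subst (λ x → block j m i ≡ block j m x) (sym i+d≡i') eq)
    where
    i+d≡i' : i + (i' ∸ i) ≡ i'
    i+d≡i' = m+[n∸m]≡n (<⇒≤ i<i')
  distinct : IsAntiPowerFix j k m
  distinct i i' i<k i'<k eq with <-cmp i i'
  ... | tri≈ _ i≡i' _ = i≡i'
  ... | tri< i<i' _ _ = ⊥-elim (ordered i<i' i'<k eq)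
  ... | tri> _ _ i'<i = ⊥-elim (ordered i'<i i<k (sym eq))

inF? : ∀ j k m → Dec (InF j k m)
inF? j k m = (m % 2 ≟ 1) ×-dec antiPower?
  where
  Injective-at : ℕ → Set
  Injective-at i = ∀ {i'} → i' < k → block j m i ≡ block j m i' → i ≡ i'
  antiPower? : Dec (IsAntiPowerFix j k m)
  antiPower? = map′ (λ inj i i' i<k i'<k → inj i<k i'<k) (λ ap {i} i<k {i'} i'<k → ap i i' i<k i'<k)
    (allUpTo? {P = Injective-at}
      (λ i → allUpTo? (λ i' → ≡-dec _≟ᵇ_ (block j m i) (block j m i') →-dec (i ≟ i')) k) k)

lastFailure : ∀ {P : ℕ → Set} → (∀ m → Dec (P m)) → ∀ n → (∀ m → n ≤ m → P m) →
              ∀ m₀ → ¬ P m₀ → Σ ℕ (λ g → ¬ P g × (∀ m → g < m → P m))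
lastFailure P? zero eventually m₀ ¬Pm₀ = ⊥-elim (¬Pm₀ (eventually m₀ z≤n))
lastFailure {P} P? (suc n) eventually m₀ ¬Pm₀ with P? n
... | no ¬Pn = n , ¬Pn , eventually
... | yes Pn = lastFailure P? n eventually′ m₀ ¬Pm₀
  where
  eventually′ : ∀ m → n ≤ m → P m
  eventually′ m n≤m with m≤n⇒m<n∨m≡n n≤m
  ... | inj₁ n<m = eventually m n<m
  ... | inj₂ refl = Pn

gamma-exists : ∀ j k n → (∀ m → Odd m → n ≤ m → InF j k m) → ∀ m₀ → Odd m₀ → ¬ InF j k m₀ →
               Σ ℕ (IsGamma j k)
gamma-exists j k n long m₀ odd₀ ¬inF₀ with
  lastFailure (λ m → (m % 2 ≟ 1) →-dec inF? j k m) n (λ m n≤m odd → long m odd n≤m)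
              m₀ (λ P → ¬inF₀ (P odd₀))
... | g , ¬Pg , above with g % 2 ≟ 1
...   | yes oddg = g , oddg , (λ inF → ¬Pg (λ _ → inF)) , (λ m odd g<m → above m g<m odd)
...   | no ¬oddg = ⊥-elim (¬Pg (λ oddg → ⊥-elim (¬oddg oddg)))

beyond-triple : ∀ k m → 3 * k ≤ m → BlocksBeyond k m
beyond-triple k m 3k≤m v h d<k =
  <-≤-trans (*-monoʳ-< 3 (≤-<-trans (m≤m*n (2 ^ v) (1 + 2 * h)) d<k)) 3k≤m

-- The length 1 is never in F_j(k) for k ≥ 3: among three letters two coincide.
one-notInF : ∀ j k → 3 ≤ k → ¬ InF j k 1
one-notInF j k 3≤k (_ , ap) with unitBlock 0 ≟ᵇ unitBlock 1 | unitBlock 0 ≟ᵇ unitBlock 2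
  where
  unitBlock : ℕ → Bool
  unitBlock i = tm (j + i * 1 + 0)
... | yes e₀₁ | _ = 0≢1 (ap 0 1 (≤-trans (s≤s z≤n) 3≤k) (≤-trans (s≤s (s≤s z≤n)) 3≤k) (cong (_∷ []) e₀₁))
  where 0≢1 : 0 ≢ 1
        0≢1 ()
... | no _ | yes e₀₂ = 0≢2 (ap 0 2 (≤-trans (s≤s z≤n) 3≤k) 3≤k (cong (_∷ []) e₀₂))
  where 0≢2 : 0 ≢ 2
        0≢2 ()
... | no ne₀₁ | no ne₀₂ =
  1≢2 (ap 1 2 (≤-trans (s≤s (s≤s z≤n)) 3≤k) 3≤k (cong (_∷ []) (not-injective (trans (sym (¬-not ne₀₁)) (¬-not ne₀₂)))))
  where 1≢2 : 1 ≢ 2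
        1≢2 ()

gamma-defined : ∀ j k → 3 ≤ k → Σ ℕ (IsGamma j k)
gamma-defined j k 3≤k =
  gamma-exists j k (3 * k) (λ m odd 3k≤m → antiPower-criterion j k m odd (beyond-triple k m 3k≤m))
    1 refl (one-notInF j k 3≤k)

-- At k = 2ⁿ⁺¹ every distance below k has 2-adic part at most 2ⁿ, so every
-- odd length above 3·2ⁿ is in F, i.e. Γ_j(2ⁿ⁺¹) ≤ 3·2ⁿ.
gamma-at-power : ∀ j n g → IsGamma j (2 ^ suc n) g → g ≤ 3 * 2 ^ n
gamma-at-power j n g (oddg , ¬inF , _) with g ≤? 3 * 2 ^ n
... | yes g≤ = g≤
... | no g≰ = ⊥-elim (¬inF (antiPower-criterion j (2 ^ suc n) g oddg beyond))
  where
  beyond : BlocksBeyond (2 ^ suc n) g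
  beyond v h d<k = <-≤-trans (s≤s (*-monoʳ-≤ 3 (power≤ (≤-<-trans (m≤m*n (2 ^ v) (1 + 2 * h)) d<k)))) (≰⇒> g≰)
    where
    power≤ : 2 ^ v < 2 ^ suc n → 2 ^ v ≤ 2 ^ n
    power≤ lt with v ≤? n
    ... | yes v≤n = ^-monoʳ-≤ 2 v≤n
    ... | no v≰n = ⊥-elim (<-irrefl refl (<-≤-trans lt (^-monoʳ-≤ 2 (≰⇒> v≰n))))

-- Agreement scales up: if t agrees at A and B on length C, then t agrees
-- at 2ⁿA + α and 2ⁿB + α on every window inside [0, C·2ⁿ), since the
-- letters there are tm (A + c) xor tm y resp. tm (B + c) xor tm y.
scaled-agree : ∀ n A B α L C → α + L ≤ C * 2 ^ n → Agree A B C →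
               Agree (2 ^ n * A + α) (2 ^ n * B + α) L
scaled-agree n A B α L C window agreeBelow = agree λ r r<L → begin
    tm (2 ^ n * A + α + r)                ≡⟨ cong tm (regroup A r) ⟩
    tm (2 ^ n * (A + c r) + y r)          ≡⟨ tm-concat n (A + c r) (y r) (m%n<n (α + r) (2 ^ n)) ⟩
    tm (A + c r) xor tm (y r)             ≡⟨ cong (_xor tm (y r)) (letter agreeBelow (c r) (c<C r r<L)) ⟩
    tm (B + c r) xor tm (y r)             ≡⟨ sym (tm-concat n (B + c r) (y r) (m%n<n (α + r) (2 ^ n))) ⟩
    tm (2 ^ n * (B + c r) + y r)          ≡⟨ cong tm (sym (regroup B r)) ⟩
    tm (2 ^ n * B + α + r)                ∎
  where
  open ≡-Reasoning
  instance
    2^n≢0 : NonZero (2 ^ n)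
    2^n≢0 = m^n≢0 2 n
  c y : ℕ → ℕ
  c r = (α + r) / 2 ^ n
  y r = (α + r) % 2 ^ n
  c<C : ∀ r → r < L → c r < C
  c<C r r<L = m<n*o⇒m/o<n (<-≤-trans (+-monoʳ-< α r<L) window)
  regroup : ∀ A r → 2 ^ n * A + α + r ≡ 2 ^ n * (A + c r) + y r
  regroup A r = begin
    2 ^ n * A + α + r                   ≡⟨ +-assoc (2 ^ n * A) α r ⟩
    2 ^ n * A + (α + r)                 ≡⟨ cong (2 ^ n * A +_) (m≡m%n+[m/n]*n (α + r) (2 ^ n)) ⟩
    2 ^ n * A + (y r + c r * 2 ^ n)     ≡⟨ distribute (2 ^ n) A (c r) (y r) ⟩
    2 ^ n * (A + c r) + y r             ∎
    where
    distribute : ∀ p A c y → p * A + (y + c * p) ≡ p * (A + c) + y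
    distribute = solve-∀

-- Blocks at distance 2ⁿ: if the i-th block starts at 2ⁿA + α, the (i + 2ⁿ)-th
-- starts at 2ⁿ(A + m) + α, and scaled-agree compares them through A versus A + m.
repeat-at-power : ∀ j m i n A α C → j + i * m ≡ 2 ^ n * A + α → α + m ≤ C * 2 ^ n →
                  Agree A (A + m) C → block j m i ≡ block j m (i + 2 ^ n)
repeat-at-power j m i n A α C start window agreeBelow =
  agree-blocks j m i (i + 2 ^ n)
    (agree-cast (sym start) shifted
      (scaled-agree n A (A + m) α m C window agreeBelow))
  where
  open ≡-Reasoning
  expand : ∀ p A α m → p * (A + m) + α ≡ p * A + α + p * m
  expand = solve-∀
  collect : ∀ j i p m → j + i * m + p * m ≡ j + (i + p) * m
  collect = solve-∀
  shifted : 2 ^ n * (A + m) + α ≡ j + (i + 2 ^ n) * m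
  shifted = begin
    2 ^ n * (A + m) + α        ≡⟨ expand (2 ^ n) A α m ⟩
    2 ^ n * A + α + 2 ^ n * m  ≡⟨ cong (_+ 2 ^ n * m) (sym start) ⟩
    j + i * m + 2 ^ n * m      ≡⟨ collect j i (2 ^ n) m ⟩
    j + (i + 2 ^ n) * m        ∎

mirror-transfer : ∀ n x x' y y' → x + y + 1 ≡ 2 ^ n → x' + y' + 1 ≡ 2 ^ n → tm y ≡ tm y' →
                  tm x ≡ tm x'
mirror-transfer n x x' y y' ex ex' ty = xor-cancelʳ (tm x) (tm x') (tm y) (begin
    tm x xor tm y    ≡⟨ tm-mirror n x y ex ⟩
    parity n         ≡⟨ sym (tm-mirror n x' y' ex') ⟩
    tm x' xor tm y'  ≡⟨ cong (tm x' xor_) (sym ty) ⟩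
    tm x' xor tm y   ∎)
  where open ≡-Reasoning

-- Agreement of short low parts lifts to numbers with the same high part j:
-- t at 2ᵃj + s + r is tm j xor tm (s + r).
low-agree : ∀ a b j s s' L → s + L ≤ 2 ^ a → s' + L ≤ 2 ^ b → Agree s s' L →
            Agree (2 ^ a * j + s) (2 ^ b * j + s') L
low-agree a b j s s' L s+L≤ s'+L≤ agr = agree λ r r<L → begin
    tm (2 ^ a * j + s + r)    ≡⟨ cong tm (+-assoc (2 ^ a * j) s r) ⟩
    tm (2 ^ a * j + (s + r))  ≡⟨ tm-concat a j (s + r) (<-≤-trans (+-monoʳ-< s r<L) s+L≤) ⟩
    tm j xor tm (s + r)       ≡⟨ cong (tm j xor_) (letter agr r r<L) ⟩
    tm j xor tm (s' + r)      ≡⟨ sym (tm-concat b j (s' + r) (<-≤-trans (+-monoʳ-< s' r<L) s'+L≤)) ⟩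
    tm (2 ^ b * j + (s' + r)) ≡⟨ cong tm (sym (+-assoc (2 ^ b * j) s' r)) ⟩
    tm (2 ^ b * j + s' + r)   ∎
  where open ≡-Reasoning

-- Blocks of length m close to 3e at distance e = 2ⁿ.  If A + m = 3e + A',
-- then tm (A + m + c) = tm (A' + c) since 3 has even digit sum, and A + c is
-- compared with A' + c through their mirror images y + 2 - c and y' + 2 - c.
far-repeat : ∀ j m i n e A A' α y y' → 2 ^ n ≡ e → j + i * m ≡ e * A + α → α + m ≤ 3 * e →
             A + m ≡ e * 3 + A' → A + y + 3 ≡ e → A' + y' + 3 ≡ e → Agree y y' 3 →
             block j m i ≡ block j m (i + e)
far-repeat j m i n .(2 ^ n) A A' α y y' refl start window wrap mirror mirror′ tails =
  repeat-at-power j m i n A α 3 start window (agree agreeBelow)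
  where
  reflect : ∀ c → c < 3 → ∀ A y → A + c + (y + (2 ∸ c)) + 1 ≡ A + y + 3
  reflect 0 _ = solve-∀
  reflect 1 _ = solve-∀
  reflect 2 _ = solve-∀
  reflect (suc (suc (suc _))) (s≤s (s≤s (s≤s ())))
  agreeBelow : ∀ c → c < 3 → tm (A + c) ≡ tm (A + m + c)
  agreeBelow c c<3 = begin
    tm (A + c)                 ≡⟨ mirror-transfer n (A + c) (A' + c) (y + (2 ∸ c)) (y' + (2 ∸ c))
                                    (trans (reflect c c<3 A y) mirror) (trans (reflect c c<3 A' y') mirror′)
                                    (letter tails (2 ∸ c) (s≤s (m∸n≤m 2 c))) ⟩
    tm (A' + c)                ≡⟨ sym (tm-concat n 3 (A' + c) A'+c<2^n) ⟩
    tm (2 ^ n * 3 + (A' + c))  ≡⟨ cong tm (trans (sym (+-assoc (2 ^ n * 3) A' c)) (cong (_+ c) (sym wrap))) ⟩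
    tm (A + m + c)             ∎
    where
    open ≡-Reasoning
    A'+c<2^n : A' + c < 2 ^ n
    A'+c<2^n = subst (A' + c <_) mirror′ (subst (suc (A' + c) ≤_) (sym (+-assoc A' y' 3))
                 (subst (_≤ A' + (y' + 3)) (+-suc A' c) (+-monoʳ-≤ A' c<3′)))
      where
      c<3′ : suc c ≤ y' + 3
      c<3′ = ≤-trans c<3 (m≤n+m 3 y')

-- Far repeats for e = 2ⁿ ≡ 4 (mod 6), written e = 48j + 6h + 34: blocks
-- i = (e - 1)/3 and i + e of odd length m = 3e - 3(8j + 5) coincide.  The
-- low parts 3, 4, 5 and 18, 19, 20 have equal digit parities, which gives
-- the hypothesis Agree (8j + 3) (32j + 18) 3 of far-repeat.
far-repeat-4mod6 : ∀ j h n → 2 ^ n ≡ 48 * j + 6 * h + 34 →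
  block j (120 * j + 18 * h + 87) (16 * j + 2 * h + 11) ≡
  block j (120 * j + 18 * h + 87) (16 * j + 2 * h + 11 + (48 * j + 6 * h + 34))
far-repeat-4mod6 j h n power =
  far-repeat j (120 * j + 18 * h + 87) (16 * j + 2 * h + 11) n (48 * j + 6 * h + 34) (40 * j + 6 * h + 28)
    (16 * j + 6 * h + 13) (9 * j + 5) (8 * j + 3) (32 * j + 18)
    power (start j h) (≤-by-excess (window j h)) (wrap j h) (mirror j h) (mirror′ j h)
    (agree-cast (low j) (low′ j)
      (low-agree 3 5 j 3 18 3 (≤ᵇ⇒≤ 6 8 _) (≤ᵇ⇒≤ 21 32 _) (agree λ { 0 _ → refl ; 1 _ → refl ; 2 _ → refl
                                                                ; (suc (suc (suc _))) (s≤s (s≤s (s≤s ()))) })))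
  where
  start : ∀ j h → j + (16 * j + 2 * h + 11) * (120 * j + 18 * h + 87) ≡ (48 * j + 6 * h + 34) * (40 * j + 6 * h + 28) + (9 * j + 5)
  start = solve-∀
  window : ∀ j h → 9 * j + 5 + (120 * j + 18 * h + 87) + (15 * j + 10) ≡ 3 * (48 * j + 6 * h + 34)
  window = solve-∀
  wrap : ∀ j h → 40 * j + 6 * h + 28 + (120 * j + 18 * h + 87) ≡ (48 * j + 6 * h + 34) * 3 + (16 * j + 6 * h + 13)
  wrap = solve-∀
  mirror : ∀ j h → 40 * j + 6 * h + 28 + (8 * j + 3) + 3 ≡ 48 * j + 6 * h + 34
  mirror = solve-∀
  mirror′ : ∀ j h → 16 * j + 6 * h + 13 + (32 * j + 18) + 3 ≡ 48 * j + 6 * h + 34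
  mirror′ = solve-∀
  low : ∀ j → 2 ^ 3 * j + 3 ≡ 8 * j + 3
  low = solve-∀
  low′ : ∀ j → 2 ^ 5 * j + 18 ≡ 32 * j + 18
  low′ = solve-∀

-- Far repeats for e = 2ⁿ ≡ 2 (mod 6), written e = 48j + 6h + 20: blocks
-- i = (e - 2)/3 and i + e of odd length m = 3e - 3(8j + 3) coincide; here
-- the low parts 2, 3, 4 and 11, 12, 13 have equal digit parities.
far-repeat-2mod6 : ∀ j h n → 2 ^ n ≡ 48 * j + 6 * h + 20 →
  block j (120 * j + 18 * h + 51) (16 * j + 2 * h + 6) ≡
  block j (120 * j + 18 * h + 51) (16 * j + 2 * h + 6 + (48 * j + 6 * h + 20))
far-repeat-2mod6 j h n power =
  far-repeat j (120 * j + 18 * h + 51) (16 * j + 2 * h + 6) n (48 * j + 6 * h + 20) (40 * j + 6 * h + 15)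
    (16 * j + 6 * h + 6) (17 * j + 6) (8 * j + 2) (32 * j + 11)
    power (start j h) (≤-by-excess (window j h)) (wrap j h) (mirror j h) (mirror′ j h)
    (agree-cast (low j) (low′ j)
      (low-agree 3 5 j 2 11 3 (≤ᵇ⇒≤ 5 8 _) (≤ᵇ⇒≤ 14 32 _) (agree λ { 0 _ → refl ; 1 _ → refl ; 2 _ → refl
                                                                ; (suc (suc (suc _))) (s≤s (s≤s (s≤s ()))) })))
  where
  start : ∀ j h → j + (16 * j + 2 * h + 6) * (120 * j + 18 * h + 51) ≡ (48 * j + 6 * h + 20) * (40 * j + 6 * h + 15) + (17 * j + 6)
  start = solve-∀
  window : ∀ j h → 17 * j + 6 + (120 * j + 18 * h + 51) + (7 * j + 3) ≡ 3 * (48 * j + 6 * h + 20)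
  window = solve-∀
  wrap : ∀ j h → 40 * j + 6 * h + 15 + (120 * j + 18 * h + 51) ≡ (48 * j + 6 * h + 20) * 3 + (16 * j + 6 * h + 6)
  wrap = solve-∀
  mirror : ∀ j h → 40 * j + 6 * h + 15 + (8 * j + 2) + 3 ≡ 48 * j + 6 * h + 20
  mirror = solve-∀
  mirror′ : ∀ j h → 16 * j + 6 * h + 6 + (32 * j + 11) + 3 ≡ 48 * j + 6 * h + 20
  mirror′ = solve-∀
  low : ∀ j → 2 ^ 3 * j + 2 ≡ 8 * j + 2
  low = solve-∀
  low′ : ∀ j → 2 ^ 5 * j + 11 ≡ 32 * j + 11
  low′ = solve-∀

mirror-true : ∀ n x y → x + y + 1 ≡ 2 ^ n → tm y ≡ not (parity n) → tm x ≡ true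
mirror-true n x y ex ty = forced (tm x) (parity n) (trans (cong (tm x xor_) (sym ty)) (tm-mirror n x y ex))
  where
  forced : ∀ a p → a xor not p ≡ p → a ≡ true
  forced true _ _ = refl
  forced false false ()
  forced false true ()

-- Blocks 0 and 2ⁿ of odd length m = 2x + 1 ≈ 2·2ⁿ, where x = 2ⁿ - 4z - 3
-- and tm z = parity n.  The mirror images 4z + 2, 4z + 1 of x, x + 1 force
-- tm x = tm (x + 1) = true, which makes the letters at m, m + 1 equal to
-- tm 0, tm 1; scaled-agree with C = 2 does the rest.
near-repeat : ∀ j n z x → tm z ≡ parity n → x + (4 * z + 3) ≡ 2 ^ n → j ≤ 8 * z + 5 →
              block j (1 + 2 * x) 0 ≡ block j (1 + 2 * x) (0 + 2 ^ n)
near-repeat j n z x tz≡p fill j≤ =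
  repeat-at-power j (1 + 2 * x) 0 n 0 j 2 (start j (2 ^ n) (1 + 2 * x)) window (agree agreeBelow)
  where
  start : ∀ j p m → j + 0 * m ≡ p * 0 + j
  start = solve-∀
  window : j + (1 + 2 * x) ≤ 2 * 2 ^ n
  window = subst (j + (1 + 2 * x) ≤_) (trans (double x z) (cong (2 *_) fill)) (+-monoˡ-≤ (1 + 2 * x) j≤)
    where
    double : ∀ x z → 8 * z + 5 + (1 + 2 * x) ≡ 2 * (x + (4 * z + 3))
    double = solve-∀
  not-tm-z : ∀ r → r < 4 → tm r ≡ true → tm (2 ^ 2 * z + r) ≡ not (parity n)
  not-tm-z r r<4 tr≡t =
    trans (tm-concat 2 z r r<4) (trans (cong (tm z xor_) tr≡t) (trans (xor-true (tm z)) (cong not tz≡p)))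
    where
    xor-true : ∀ b → b xor true ≡ not b
    xor-true false = refl
    xor-true true = refl
  tm-x : tm x ≡ true
  tm-x = mirror-true n x (2 ^ 2 * z + 2) (trans (mirror₀ x z) fill) (not-tm-z 2 (≤ᵇ⇒≤ 3 4 _) refl)
    where
    mirror₀ : ∀ x z → x + (2 ^ 2 * z + 2) + 1 ≡ x + (4 * z + 3)
    mirror₀ = solve-∀
  tm-x+1 : tm (suc x) ≡ true
  tm-x+1 = mirror-true n (suc x) (2 ^ 2 * z + 1) (trans (mirror₁ x z) fill) (not-tm-z 1 (≤ᵇ⇒≤ 2 4 _) refl)
    where
    mirror₁ : ∀ x z → suc x + (2 ^ 2 * z + 1) + 1 ≡ x + (4 * z + 3)
    mirror₁ = solve-∀
  agreeBelow : ∀ c → c < 2 → tm (0 + c) ≡ tm (0 + (1 + 2 * x) + c)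
  agreeBelow 0 _ = sym (trans (cong tm (+-identityʳ (1 + 2 * x))) (trans (tm-odd x) (cong not tm-x)))
  agreeBelow 1 _ = sym (trans (cong tm (next x)) (trans (tm-even (suc x)) tm-x+1))
    where
    next : ∀ x → 1 + 2 * x + 1 ≡ 2 * suc x
    next = solve-∀
  agreeBelow (suc (suc _)) (s≤s (s≤s ()))

RepeatedBlock : ℕ → ℕ → ℕ → Set
RepeatedBlock j k m = Σ ℕ λ i → Σ ℕ λ d → 0 < d × i + d < k × block j m i ≡ block j m (i + d)

repeat-below-gamma : ∀ j k m g → IsGamma j k g → Odd m → RepeatedBlock j k m → m ≤ g
repeat-below-gamma j k m g (_ , _ , above) odd (i , suc d , _ , i+d<k , eq) with m ≤? g
... | yes m≤g = m≤g
... | no m≰g = ⊥-elim (m+1+n≢m i (proj₂ (above m odd (≰⇒> m≰g)) (i + suc d) i i+d<k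
                                        (≤-<-trans (m≤m+n i (suc d)) i+d<k) (sym eq)))

-- A witness that Γ_j(k) ≥ 3k/2 - (24j + 15): an odd length m with a
-- repeated block and 3k ≤ 2m + 2(24j + 15).
LowerWitness : ℕ → ℕ → Set
LowerWitness j k = Σ ℕ λ m → Odd m × RepeatedBlock j k m × 3 * k ≤ 2 * m + 2 * (24 * j + 15)

prescribed-letter : ∀ j b → Σ ℕ λ z → tm z ≡ b × 2 * j ≤ z × z ≤ 1 + 2 * j
prescribed-letter j b with tm j ≟ᵇ b
... | yes tj≡b = 2 * j , trans (tm-even j) tj≡b , ≤-refl , n≤1+n _
... | no tj≢b = 1 + 2 * j , trans (tm-odd j) (trans (cong not (¬-not tj≢b)) (not-involutive b)) , n≤1+n _ , ≤-refl

-- For 2ⁿ < k with 3k < 4·2ⁿ, near-repeat gives m ≈ 2·2ⁿ > 3k/2.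
near-witness : ∀ j n k → 2 ^ n < k → 3 * k < 4 * 2 ^ n → 8 * j + 7 ≤ 2 ^ n → LowerWitness j k
near-witness j n k 2^n<k 3k<4e big with prescribed-letter j (parity n)
... | z , tz≡p , 2j≤z , z≤ = 1 + 2 * x , 1+2*n%2≡1 x , repeated , defect
  where
  4z+3≤ : 4 * z + 3 ≤ 2 ^ n
  4z+3≤ = ≤-trans (+-monoˡ-≤ 3 (*-monoʳ-≤ 4 z≤)) (≤-trans (≤-reflexive (bound j)) big)
    where
    bound : ∀ j → 4 * (1 + 2 * j) + 3 ≡ 8 * j + 7
    bound = solve-∀
  x = 2 ^ n ∸ (4 * z + 3)
  fill : x + (4 * z + 3) ≡ 2 ^ n
  fill = m∸n+n≡m 4z+3≤
  repeated : RepeatedBlock j k (1 + 2 * x)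
  repeated = 0 , 2 ^ n , m^n>0 2 n , 2^n<k ,
    near-repeat j n z x tz≡p fill (≤-trans (m≤n*m j 2) (≤-trans 2j≤z (≤-trans (m≤n*m z 8) (m≤m+n (8 * z) 5))))
  defect : 3 * k ≤ 2 * (1 + 2 * x) + 2 * (24 * j + 15)
  defect = ≤-trans (<⇒≤ 3k<4e) (subst (_≤ 2 * (1 + 2 * x) + 2 * (24 * j + 15)) (trans (four x z) (cong (4 *_) fill))
             (+-monoʳ-≤ (2 * (1 + 2 * x)) (≤-trans (+-monoˡ-≤ 10 (*-monoʳ-≤ 16 z≤)) (≤-by-excess (slack j)))))
    where
    four : ∀ x z → 2 * (1 + 2 * x) + (16 * z + 10) ≡ 4 * (x + (4 * z + 3))
    four = solve-∀
    slack : ∀ j → 16 * (1 + 2 * j) + 10 + (16 * j + 4) ≡ 2 * (24 * j + 15)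
    slack = solve-∀

far-witness : ∀ j k m i e → 0 < e → Odd m → block j m i ≡ block j m (i + e) → i + e < k →
              k ≤ 2 * e → 3 * (2 * e) ≤ 2 * m + 2 * (24 * j + 15) → LowerWitness j k
far-witness j k m i e e>0 odd eq fits k≤2e defect =
  m , odd , (i , e , e>0 , fits , eq) , ≤-trans (*-monoʳ-≤ 3 k≤2e) defect

-- If the far repeat at distance e does not fit below k, then k ≤ i + e and
-- so 3k < 4e, the range of near-witness.
too-short : ∀ i e k → ¬ (i + e < k) → 3 * (i + e) < 4 * e → 3 * k < 4 * e
too-short i e k ¬fits 3[i+e]<4e = ≤-<-trans (*-monoʳ-≤ 3 (≮⇒≥ ¬fits)) 3[i+e]<4e

power-mod-6 : ∀ n → Σ ℕ λ i → (2 ^ suc n ≡ 6 * i + 4) ⊎ (2 ^ suc n ≡ 6 * i + 2)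
power-mod-6 zero = 0 , inj₂ refl
power-mod-6 (suc n) with power-mod-6 n
... | i , inj₁ e≡ = 1 + 2 * i , inj₂ (trans (cong (2 *_) e≡) (double₄ i))
  where
  double₄ : ∀ i → 2 * (6 * i + 4) ≡ 6 * (1 + 2 * i) + 2
  double₄ = solve-∀
... | i , inj₂ e≡ = 2 * i , inj₁ (trans (cong (2 *_) e≡) (double₂ i))
  where
  double₂ : ∀ i → 2 * (6 * i + 2) ≡ 6 * (2 * i) + 4
  double₂ = solve-∀

power-shape : ∀ j n → 48 * j + 48 ≤ 2 ^ n →
              Σ ℕ λ h → (2 ^ n ≡ 48 * j + 6 * h + 34) ⊎ (2 ^ n ≡ 48 * j + 6 * h + 20)
power-shape j zero big = ⊥-elim (<-irrefl refl (≤-trans (≤ᵇ⇒≤ 2 48 _) (≤-trans (m≤n+m 48 (48 * j)) big)))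
power-shape j (suc n) big with power-mod-6 n
... | i , inj₁ e≡ = i ∸ (8 * j + 5) , inj₁ (trans e≡ (trans (cong (λ t → 6 * t + 4) (sym (m+[n∸m]≡n i≥))) (shape j _)))
  where
  i≥ : 8 * j + 5 ≤ i
  i≥ = *-cancelˡ-≤ 6 (+-cancelʳ-≤ 4 _ _ (≤-trans (≤-by-excess (low j)) (subst (48 * j + 48 ≤_) e≡ big)))
    where
    low : ∀ j → 6 * (8 * j + 5) + 4 + 14 ≡ 48 * j + 48
    low = solve-∀
  shape : ∀ j h → 6 * (8 * j + 5 + h) + 4 ≡ 48 * j + 6 * h + 34
  shape = solve-∀
... | i , inj₂ e≡ = i ∸ (8 * j + 3) , inj₂ (trans e≡ (trans (cong (λ t → 6 * t + 2) (sym (m+[n∸m]≡n i≥))) (shape j _)))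
  where
  i≥ : 8 * j + 3 ≤ i
  i≥ = *-cancelˡ-≤ 6 (+-cancelʳ-≤ 2 _ _ (≤-trans (≤-by-excess (low j)) (subst (48 * j + 48 ≤_) e≡ big)))
    where
    low : ∀ j → 6 * (8 * j + 3) + 2 + 28 ≡ 48 * j + 48
    low = solve-∀
  shape : ∀ j h → 6 * (8 * j + 3 + h) + 2 ≡ 48 * j + 6 * h + 20
  shape = solve-∀

-- Every k in a dyadic window (2ⁿ, 2ⁿ⁺¹] with 2ⁿ ≥ 48j + 48 has a lower witness:
-- the far repeat of the matching shape if it fits below k, else a near repeat.
lower-witness : ∀ j n k → 2 ^ n < k → k ≤ 2 * 2 ^ n → 48 * j + 48 ≤ 2 ^ n → LowerWitness j k
lower-witness j n k e<k k≤2e big with power-shape j n big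
... | h , inj₁ e≡ with 16 * j + 2 * h + 11 + (48 * j + 6 * h + 34) <? k
...   | yes fits =
  far-witness j k (120 * j + 18 * h + 87) (16 * j + 2 * h + 11) (48 * j + 6 * h + 34) (subst (0 <_) e≡ (m^n>0 2 n))
    (subst Odd (sym (odd j h)) (1+2*n%2≡1 (60 * j + 9 * h + 43))) (far-repeat-4mod6 j h n e≡) fits
    (subst (λ e → k ≤ 2 * e) e≡ k≤2e) (≤-reflexive (six j h))
  where
  odd : ∀ j h → 120 * j + 18 * h + 87 ≡ 1 + 2 * (60 * j + 9 * h + 43)
  odd = solve-∀
  six : ∀ j h → 3 * (2 * (48 * j + 6 * h + 34)) ≡ 2 * (120 * j + 18 * h + 87) + 2 * (24 * j + 15)
  six = solve-∀
...   | no ¬fits = near-witness j n k e<k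
  (subst (λ e → 3 * k < 4 * e) (sym e≡) (too-short (16 * j + 2 * h + 11) (48 * j + 6 * h + 34) k ¬fits (≤-reflexive (four j h))))
  (≤-trans (≤-by-excess (margin j)) big)
  where
  four : ∀ j h → suc (3 * (16 * j + 2 * h + 11 + (48 * j + 6 * h + 34))) ≡ 4 * (48 * j + 6 * h + 34)
  four = solve-∀
  margin : ∀ j → 8 * j + 7 + (40 * j + 41) ≡ 48 * j + 48
  margin = solve-∀
lower-witness j n k e<k k≤2e big | h , inj₂ e≡ with 16 * j + 2 * h + 6 + (48 * j + 6 * h + 20) <? k
...   | yes fits =
  far-witness j k (120 * j + 18 * h + 51) (16 * j + 2 * h + 6) (48 * j + 6 * h + 20) (subst (0 <_) e≡ (m^n>0 2 n))
    (subst Odd (sym (odd j h)) (1+2*n%2≡1 (60 * j + 9 * h + 25))) (far-repeat-2mod6 j h n e≡) fits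
    (subst (λ e → k ≤ 2 * e) e≡ k≤2e) (≤-by-excess (six j h))
  where
  odd : ∀ j h → 120 * j + 18 * h + 51 ≡ 1 + 2 * (60 * j + 9 * h + 25)
  odd = solve-∀
  six : ∀ j h → 3 * (2 * (48 * j + 6 * h + 20)) + 12 ≡ 2 * (120 * j + 18 * h + 51) + 2 * (24 * j + 15)
  six = solve-∀
...   | no ¬fits = near-witness j n k e<k
  (subst (λ e → 3 * k < 4 * e) (sym e≡) (too-short (16 * j + 2 * h + 6) (48 * j + 6 * h + 20) k ¬fits (≤-by-excess (four j h))))
  (≤-trans (≤-by-excess (margin j)) big)
  where
  four : ∀ j h → suc (3 * (16 * j + 2 * h + 6 + (48 * j + 6 * h + 20))) + 1 ≡ 4 * (48 * j + 6 * h + 20)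
  four = solve-∀
  margin : ∀ j → 8 * j + 7 + (40 * j + 41) ≡ 48 * j + 48
  margin = solve-∀

dyadic-window : ∀ k → 2 ≤ k → Σ ℕ λ n → 2 ^ n < k × k ≤ 2 * 2 ^ n
dyadic-window (suc zero) (s≤s ())
dyadic-window (suc (suc X)) _ with window X
  where
  window : ∀ X → Σ ℕ λ n → 2 ^ n ≤ suc X × suc X < 2 * 2 ^ n
  window zero = 0 , ≤-refl , ≤-refl
  window (suc X) with window X
  ... | n , lo , hi with suc (suc X) <? 2 * 2 ^ n
  ...   | yes hi′ = n , ≤-trans lo (n≤1+n _) , hi′
  ...   | no ¬hi′ = suc n , ≮⇒≥ ¬hi′ , ≤-trans (s≤s hi) (p<2p (2 ^ suc n) (m^n>0 2 (suc n)))
    where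
    p<2p : ∀ p → 0 < p → suc p ≤ 2 * p
    p<2p p p>0 = subst (_≤ 2 * p) (+-comm p 1) (+-monoʳ-≤ p (≤-trans p>0 (m≤m+n p 0)))
... | n , lo , hi = n , s≤s lo , hi

-- The ratio estimate: if 3k ≤ 2m + 2T, Q·T < k and m ≤ g, then
-- g/k > 3/2 - 1/Q, in the cleared form 3Qk < 2Qg + 2k.
ratio-bound : ∀ Q k m T g → 3 * k ≤ 2 * m + 2 * T → Q * T < k → m ≤ g → 3 * Q * k < 2 * Q * g + 2 * k
ratio-bound Q k m T g defect QT<k m≤g = begin-strict
  3 * Q * k              ≡⟨ rearrange₁ Q k ⟩
  Q * (3 * k)            ≤⟨ *-monoʳ-≤ Q defect ⟩
  Q * (2 * m + 2 * T)    ≡⟨ rearrange₂ Q m T ⟩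
  2 * Q * m + 2 * (Q * T) <⟨ +-monoʳ-< (2 * Q * m) (*-monoʳ-< 2 QT<k) ⟩
  2 * Q * m + 2 * k      ≤⟨ +-monoˡ-≤ (2 * k) (*-monoʳ-≤ (2 * Q) m≤g) ⟩
  2 * Q * g + 2 * k      ∎
  where
  open ≤-Reasoning
  rearrange₁ : ∀ Q k → 3 * Q * k ≡ Q * (3 * k)
  rearrange₁ = solve-∀
  rearrange₂ : ∀ Q m T → Q * (2 * m + 2 * T) ≡ 2 * Q * m + 2 * (Q * T)
  rearrange₂ = solve-∀

-- Beyond 96j + 96 + Q(24j + 15), Γ_j(k)/k > 3/2 - 1/Q: locate k in its
-- dyadic window, take a lower witness there and apply ratio-bound.
lower-bound-beyond : ∀ j Q k g → 96 * j + 96 + Q * (24 * j + 15) < k → IsGamma j k g →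
                     3 * Q * k < 2 * Q * g + 2 * k
lower-bound-beyond j Q k g large isΓ = in-window (dyadic-window k 2≤k)
  where
  base≤k : 96 * j + 96 ≤ k
  base≤k = ≤-trans (m≤m+n (96 * j + 96) (Q * (24 * j + 15))) (<⇒≤ large)
  2≤k : 2 ≤ k
  2≤k = ≤-trans (≤ᵇ⇒≤ 2 96 _) (≤-trans (m≤n+m 96 (96 * j)) base≤k)
  conclude : LowerWitness j k → 3 * Q * k < 2 * Q * g + 2 * k
  conclude (m , odd , repeated , defect) =
    ratio-bound Q k m (24 * j + 15) g defect (≤-trans (s≤s (m≤n+m (Q * (24 * j + 15)) (96 * j + 96))) large)
      (repeat-below-gamma j k m g isΓ odd repeated)
  in-window : (Σ ℕ λ n → 2 ^ n < k × k ≤ 2 * 2 ^ n) → 3 * Q * k < 2 * Q * g + 2 * k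
  in-window (n , e<k , k≤2e) = conclude (lower-witness j n k e<k k≤2e big)
    where
    double : ∀ j → 2 * (48 * j + 48) ≡ 96 * j + 96
    double = solve-∀
    big : 48 * j + 48 ≤ 2 ^ n
    big = *-cancelˡ-≤ 2 (≤-trans (≤-reflexive (double j)) (≤-trans base≤k k≤2e))

gamma-eventually-large : ∀ j q → Σ ℕ λ K → ∀ k → K ≤ k → ∀ g → IsGamma j k g →
                         3 * suc q * k < 2 * suc q * g + 2 * k
gamma-eventually-large j q =
  suc (96 * j + 96 + suc q * (24 * j + 15)) , λ k K≤k g isΓ → lower-bound-beyond j (suc q) k g K≤k isΓ

n<2^n : ∀ n → n < 2 ^ n
n<2^n zero = s≤s z≤n
n<2^n (suc n) = subst (_≤ 2 * 2 ^ n) (+-comm (suc n) 1) (+-mono-≤ (n<2^n n) (≤-trans (m^n>0 2 n) (m≤m+n _ 0)))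

-- liminf Γ_j(k)/k ≤ 3/2: along k = 2ⁿ⁺¹, Γ_j(k) ≤ 3k/2 (gamma-at-power).
gamma-infinitely-small : ∀ j q K → Σ ℕ λ k → K ≤ k × Σ ℕ λ g → IsGamma j k g ×
                         2 * suc q * g < 3 * suc q * k + 2 * k
gamma-infinitely-small j q K = 2 ^ suc n , K≤k , at-power (gamma-defined j (2 ^ suc n) 3≤k)
  where
  n = suc K
  K≤k : K ≤ 2 ^ suc n
  K≤k = ≤-trans (<⇒≤ (n<2^n K)) (^-monoʳ-≤ 2 (≤-trans (n≤1+n K) (n≤1+n n)))
  3≤k : 3 ≤ 2 ^ suc n
  3≤k = ≤-trans (≤ᵇ⇒≤ 3 4 _) (^-monoʳ-≤ 2 {2} {suc n} (s≤s (s≤s z≤n)))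
  rearrange : ∀ Q p → 2 * Q * (3 * p) ≡ 3 * Q * (2 * p)
  rearrange = solve-∀
  at-power : Σ ℕ (IsGamma j (2 ^ suc n)) →
             Σ ℕ λ g → IsGamma j (2 ^ suc n) g × 2 * suc q * g < 3 * suc q * 2 ^ suc n + 2 * 2 ^ suc n
  at-power (g , isΓ) = g , isΓ , (begin-strict
    2 * suc q * g                                 ≤⟨ *-monoʳ-≤ (2 * suc q) (gamma-at-power j n g isΓ) ⟩
    2 * suc q * (3 * 2 ^ n)                       ≡⟨ rearrange (suc q) (2 ^ n) ⟩
    3 * suc q * 2 ^ suc n                         <⟨ m<m+n (3 * suc q * 2 ^ suc n) (*-monoʳ-< 2 (m^n>0 2 (suc n))) ⟩
    3 * suc q * 2 ^ suc n + 2 * 2 ^ suc n         ∎)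
    where open ≤-Reasoning

mainTheorem4 : (j : ℕ) →
    Σ ℕ (λ K → ∀ k → K ≤ k → Σ ℕ (λ g → IsGamma j k g))
    × (∀ q → Σ ℕ (λ K → ∀ k → K ≤ k → ∀ g → IsGamma j k g →
          3 * suc q * k < 2 * suc q * g + 2 * k))
    × (∀ q K → Σ ℕ (λ k → K ≤ k × Σ ℕ (λ g → IsGamma j k g ×
          2 * suc q * g < 3 * suc q * k + 2 * k)))
mainTheorem4 j = (3 , gamma-defined j) , gamma-eventually-large j , gamma-infinitely-small j
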